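{- Let $x:\mathbb{R}_D$ be equipped with a locator and let $\varepsilon$ be a positive rational. Then one can construct $u,v:\mathbb{Q}$ with $u<x<v$ and $v-u<\varepsilon$.
   Context: Work in Martin-Löf type theory with propositional truncation, function extensionality and propositional extensionality. A Dedekind real is a pair $x=(L,U)$ of proposition-valued predicates on $\mathbb{Q}$, writing $q<x$ for $q\in L$ and $x<r$ for $r\in U$, which is bounded, rounded, transitive ($q<x\land x<r\Rightarrow q<r$) and located ($q<r\Rightarrow\|(q<x)+(x<r)\|$). $\mathbb{R}_D$ is the type of Dedekind reals. A locator for $x$ is a function $\prod_{q,r:\mathbb{Q}}(q<r)\to(q<x)+(x<r)$ into the untruncated disjoint sum. "Construct" means produce an element of the corresponding untruncated $\Sigma$-type. -}

module Defs where

open import Level using (Level; _⊔_) renaming (suc to lsuc; zero to lzero)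
open import Data.Product using (Σ; _×_; _,_)
open import Data.Sum using (_⊎_)
open import Data.Rational using (ℚ; _<_)
open import Relation.Binary.PropositionalEquality using (_≡_)

isProp : Set → Set
isProp A = (a b : A) → a ≡ b

-- Propositional truncation, encoded impredicatively (no HITs available in --safe stdlib Agda).
-- It eliminates into every proposition of Set.
∥_∥ : Set → Set₁
∥ A ∥ = (P : Set) → isProp P → (A → P) → P

∣_∣ : {A : Set} → A → ∥ A ∥
∣ a ∣ = λ P _ f → f a

record ℝD : Set₁ where
  field
    L U : ℚ → Set
    L-prop : ∀ q → isProp (L q)
    U-prop : ∀ r → isProp (U r)
    bounded-L : ∥ Σ ℚ L ∥
    bounded-U : ∥ Σ ℚ U ∥
    rounded-L : ∀ q → (L q → ∥ Σ ℚ (λ q' → (q < q') × L q') ∥)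
                    × (∥ Σ ℚ (λ q' → (q < q') × L q') ∥ → L q)
    rounded-U : ∀ r → (U r → ∥ Σ ℚ (λ r' → (r' < r) × U r') ∥)
                    × (∥ Σ ℚ (λ r' → (r' < r) × U r') ∥ → U r)
    transitive : ∀ q r → L q → U r → q < r
    located : ∀ q r → q < r → ∥ L q ⊎ U r ∥

open ℝD public

_<ℝ_ : ℚ → ℝD → Set
q <ℝ x = L x q

_ℝ<_ : ℝD → ℚ → Set
x ℝ< r = U x r

Locator : ℝD → Set
Locator x = (q r : ℚ) → q < r → (q <ℝ x) ⊎ (x ℝ< r)

module Submission where

-- The locator decides, for each pair q < r, one of q < x or x < r, and these decisions
-- can be inspected.  Boundedness of x only gives a truncated bound; we turn it into an
-- actual one by a Markov-style search: a Bool-valued predicate on ℕ that merely holds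
-- somewhere has a unique least witness, so the truncation eliminates into the
-- proposition "there is a least witness" (module LeastWitness, lemma findLeft).
-- Applied to the locator decisions on the intervals (n, n+1) and (-(n+1), -n), together
-- with the Archimedean property of ℚ, this yields a lower bound a and an upper bound b.
-- Finally we walk upward from a in steps of h: at each step the locator either moves
-- the known lower bound up by h, or certifies x < c + 2h, giving the interval
-- (c, c + 2h).  Since x < b < a + n·h for some n, the walk stops after at most n steps
-- (lemma scan).  Taking h = ε/4 gives an interval of width ε/2 < ε.

open import Defs
open import Data.Bool using (Bool; true; false; T; not; _∨_)
open import Data.Bool.Properties using (T-irrelevant; T-∨; T-not-≡)
open import Data.Empty using (⊥-elim)
open import Data.Maybe using (is-just; to-witness-T)
open import Data.Nat as ℕ using (ℕ; zero; suc)
import Data.Nat.Properties as ℕ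
open import Data.Nat.Coprimality using (1-coprimeTo) renaming (sym to coprime-sym)
import Data.Integer as ℤ
import Data.Integer.Properties as ℤ
open import Data.Product using (Σ; _×_; _,_; proj₁; proj₂)
open import Data.Rational
  using (ℚ; mkℚ; _<_; _-_; 0ℚ; 1ℚ; ½; _+_; _*_; -_; 1/_; *<*; Positive; NonZero; positive)
open import Data.Rational.Properties
import Data.Rational.Unnormalised as ℚᵘ
import Data.Rational.Unnormalised.Properties as ℚᵘ
open import Data.Rational.Solver using (module +-*-Solver)
open import Data.Sum using (_⊎_; inj₁; inj₂; isInj₁; swap)
open import Function using (_∘_; Equivalence)
open import Relation.Binary.Definitions using (tri<; tri≈; tri>)
open import Relation.Binary.PropositionalEquality
open import Relation.Nullary using (¬_)

open Equivalence using (to; from)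
open +-*-Solver using (solve; _:=_; _:+_; _:*_; :-_; _:-_; con)

∥-map : {A B : Set} → (A → B) → ∥ A ∥ → ∥ B ∥
∥-map f a P P-prop g = a P P-prop (g ∘ f)

-- Unique choice for Bool-valued predicates on ℕ: the least witness of p is unique, so
-- the type of least witnesses is a proposition, into which a truncated witness eliminates.
module LeastWitness (p : ℕ → Bool) where

  anyBelow : ℕ → Bool
  anyBelow zero    = false
  anyBelow (suc n) = anyBelow n ∨ p n

  IsLeast : ℕ → Set
  IsLeast n = T (p n) × T (not (anyBelow n))

  anyBelow-intro : ∀ {m n} → m ℕ.< n → T (p m) → T (anyBelow n)
  anyBelow-intro {m} {suc n} (ℕ.s≤s m≤n) pm with ℕ.m≤n⇒m<n∨m≡n m≤n
  ... | inj₁ m<n  = from T-∨ (inj₁ (anyBelow-intro m<n pm))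
  ... | inj₂ refl = from T-∨ (inj₂ pm)

  below-least : ∀ {m n} → m ℕ.< n → T (p m) → ¬ IsLeast n
  below-least m<n pm (_ , none) = subst T (to T-not-≡ none) (anyBelow-intro m<n pm)

  least-unique : ∀ {m n} → IsLeast m → IsLeast n → m ≡ n
  least-unique {m} {n} lm ln with ℕ.<-cmp m n
  ... | tri< m<n _ _ = ⊥-elim (below-least m<n (proj₁ lm) ln)
  ... | tri≈ _ m≡n _ = m≡n
  ... | tri> _ _ n<m = ⊥-elim (below-least n<m (proj₁ ln) lm)

  Least : Set
  Least = Σ ℕ IsLeast

  Least-prop : isProp Least
  Least-prop (m , lm) (n , ln) with least-unique lm ln
  ... | refl = cong₂ (λ pm none → m , pm , none) (T-irrelevant _ _) (T-irrelevant _ _)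

  leastBelow : ∀ n → T (anyBelow n) → Least
  leastBelow (suc n) h with anyBelow n in eq
  ... | true  = leastBelow n (subst T (sym eq) _)
  ... | false = n , h , subst (T ∘ not) (sym eq) _

  search : ∥ Σ ℕ (T ∘ p) ∥ → Σ ℕ (T ∘ p)
  search w =
    let n , pn , _ = w Least Least-prop (λ (n , pn) → leastBelow (suc n) (from T-∨ (inj₂ pn)))
    in n , pn

leftUnlessRight : {A B : Set} (s : A ⊎ B) → ¬ B → T (is-just (isInj₁ s))
leftUnlessRight (inj₁ _) _  = _
leftUnlessRight (inj₂ b) ¬b = ¬b b

findLeft : {A B : ℕ → Set} (s : ∀ n → A n ⊎ B n) → ∥ Σ ℕ (λ n → ¬ B n) ∥ → Σ ℕ A
findLeft s w =
  let n , left = search (∥-map (λ (n , ¬b) → n , leftUnlessRight (s n) ¬b) w)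
  in n , to-witness-T (isInj₁ (s n)) left
  where open LeastWitness (λ n → is-just (isInj₁ (s n)))

q<q+d : ∀ q {d} → 0ℚ < d → q < q + d
q<q+d q {d} 0<d = subst (_< q + d) (+-identityʳ q) (+-monoʳ-< q 0<d)

half+half : ∀ q → ½ * q + ½ * q ≡ q
half+half q = trans (sym (*-distribʳ-+ q ½ ½)) (*-identityˡ q)

half-pos : ∀ {q} → 0ℚ < q → 0ℚ < ½ * q
half-pos {q} 0<q = subst (_< ½ * q) (*-zeroʳ ½) (*-monoʳ-<-pos ½ 0<q)

half<self : ∀ {q} → 0ℚ < q → ½ * q < q
half<self {q} 0<q = subst (½ * q <_) (half+half q) (q<q+d (½ * q) (half-pos 0<q))

neg-involutive : ∀ q → - (- q) ≡ q
neg-involutive = solve 1 (λ q → :- (:- q) := q) refl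

fromℕ : ℕ → ℚ
fromℕ n = mkℚ (ℤ.+ n) 0 (coprime-sym (1-coprimeTo n))

fromℕ-suc : ∀ n → fromℕ (suc n) ≡ fromℕ n + 1ℚ
fromℕ-suc n = toℚᵘ-injective (ℚᵘ.≃-trans
  (ℚᵘ.≃-reflexive (cong (λ k → ℚᵘ.mkℚᵘ k 0) numerators))
  (ℚᵘ.≃-sym (toℚᵘ-homo-+ (fromℕ n) 1ℚ)))
  where
  -- toℚᵘ (fromℕ n) + toℚᵘ 1ℚ computes to the fraction (n·1 + 1·1) / 1
  numerators : ℤ.+ suc n ≡ ℤ.+ n ℤ.* ℤ.+ 1 ℤ.+ ℤ.+ 1 ℤ.* ℤ.+ 1
  numerators = begin
    ℤ.+ suc n                 ≡⟨ cong ℤ.+_ (ℕ.+-comm 1 n) ⟩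
    ℤ.+ n ℤ.+ ℤ.+ 1           ≡⟨ cong (ℤ._+ ℤ.+ 1) (ℤ.*-identityʳ (ℤ.+ n)) ⟨
    ℤ.+ n ℤ.* ℤ.+ 1 ℤ.+ ℤ.+ 1 ∎
    where open ≡-Reasoning

fromℕ-<-suc : ∀ n → fromℕ n < fromℕ (suc n)
fromℕ-<-suc n = subst (fromℕ n <_) (sym (fromℕ-suc n)) (q<q+d (fromℕ n) (positive⁻¹ 1ℚ))

archimedean : ∀ q → Σ ℕ (λ n → q < fromℕ n)
archimedean (mkℚ ℤ.-[1+ k ] d _) = 0 , *<* ℤ.-<+
archimedean (mkℚ (ℤ.+ k) d _)    = suc k , *<* cross-multiplied
  where
  -- k/(d+1) < k+1, i.e. after cross-multiplying, k·1 < (k+1)(d+1)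
  k*1<sk*sd : k ℕ.* 1 ℕ.< suc k ℕ.* suc d
  k*1<sk*sd = ℕ.≤-<-trans (ℕ.*-monoʳ-≤ k (ℕ.s≤s ℕ.z≤n)) (ℕ.*-monoˡ-< (suc d) (ℕ.n<1+n k))
  cross-multiplied : ℤ.+ k ℤ.* ℤ.+ 1 ℤ.< ℤ.+ suc k ℤ.* ℤ.+ suc d
  cross-multiplied =
    subst₂ ℤ._<_ (ℤ.pos-* k 1) (ℤ.pos-* (suc k) (suc d)) (ℤ.+<+ k*1<sk*sd)

archimedean⁻ : ∀ q → Σ ℕ (λ n → - fromℕ n < q)
archimedean⁻ q =
  let n , -q<n = archimedean (- q)
  in n , subst (- fromℕ n <_) (neg-involutive q) (neg-antimono-< -q<n)

exceeds : ∀ a b {h} → 0ℚ < h → Σ ℕ (λ n → b < a + fromℕ n * h)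
exceeds a b {h} 0<h =
  let n , [b-a]/h<n = archimedean ((b - a) * 1/ h)
  in n , (begin-strict
    b                            ≡⟨ solve 2 (λ a b → b := a :+ (b :- a) :* con 1ℚ) refl a b ⟩
    a + (b - a) * 1ℚ             ≡⟨ cong (λ t → a + (b - a) * t) (*-inverseˡ h) ⟨
    a + (b - a) * (1/ h * h)     ≡⟨ cong (a +_) (*-assoc (b - a) (1/ h) h) ⟨
    a + (b - a) * 1/ h * h       <⟨ +-monoʳ-< a (*-monoˡ-<-pos h [b-a]/h<n) ⟩
    a + fromℕ n * h              ∎)
  where
  open ≤-Reasoning
  instance
    h-positive : Positive h
    h-positive = positive 0<h
    h-nonZero : NonZero h
    h-nonZero = pos⇒nonZero h

upward : (x : ℝD) → ∀ {r r'} → x ℝ< r → r < r' → x ℝ< r'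
upward x {r} {r'} x<r r<r' = proj₂ (rounded-U x r') ∣ r , r<r' , x<r ∣

module WithLocator (x : ℝD) (locate : Locator x) where

  -- Search the locator's decisions on (-(n+1), -n) for one that places x above -(n+1);
  -- it exists, merely, since x has some lower bound q and -n < q for large n.
  lowerBound : Σ ℚ (_<ℝ x)
  lowerBound =
    let n , above = findLeft decide (∥-map refute (bounded-L x))
    in - fromℕ (suc n) , above
    where
    decide : ∀ n → ((- fromℕ (suc n)) <ℝ x) ⊎ (x ℝ< (- fromℕ n))
    decide n = locate (- fromℕ (suc n)) (- fromℕ n) (neg-antimono-< (fromℕ-<-suc n))
    refute : Σ ℚ (_<ℝ x) → Σ ℕ (λ n → ¬ (x ℝ< (- fromℕ n)))
    refute (q , q<x) =
      let n , -n<q = archimedean⁻ q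
      in n , λ x<-n → <-asym -n<q (transitive x q (- fromℕ n) q<x x<-n)

  upperBound : Σ ℚ (x ℝ<_)
  upperBound =
    let n , below = findLeft (swap ∘ decide) (∥-map refute (bounded-U x))
    in fromℕ (suc n) , below
    where
    decide : ∀ n → (fromℕ n <ℝ x) ⊎ (x ℝ< fromℕ (suc n))
    decide n = locate (fromℕ n) (fromℕ (suc n)) (fromℕ-<-suc n)
    refute : Σ ℚ (x ℝ<_) → Σ ℕ (λ n → ¬ (fromℕ n <ℝ x))
    refute (r , x<r) =
      let n , r<n = archimedean r
      in n , λ n<x → <-asym r<n (transitive x (fromℕ n) r n<x x<r)

  -- The locator on (c + h, c + 2h)
  -- either raises the lower bound to c + h or yields the interval (c, c + 2h); since
  -- x < c + n·h, the walk cannot pass n steps.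
  scan : ∀ {h} → 0ℚ < h → ∀ n c → c <ℝ x → x ℝ< (c + fromℕ n * h)
       → Σ ℚ (λ u → (u <ℝ x) × (x ℝ< (u + (h + h))))
  scan {h} 0<h zero c c<x x<c+0h =
    ⊥-elim (<-irrefl refl (transitive x c c c<x (subst (x ℝ<_) c+0h≡c x<c+0h)))
    where
    c+0h≡c : c + 0ℚ * h ≡ c
    c+0h≡c = trans (cong (c +_) (*-zeroˡ h)) (+-identityʳ c)
  scan {h} 0<h (suc n) c c<x x<c+[n+1]h =
    step (locate (c + h) (c + (h + h)) (+-monoʳ-< c (q<q+d h 0<h)))
    where
    one-step : c + fromℕ (suc n) * h ≡ (c + h) + fromℕ n * h
    one-step = trans (cong (λ t → c + t * h) (fromℕ-suc n))
      (solve 3 (λ c m h → c :+ (m :+ con 1ℚ) :* h := (c :+ h) :+ m :* h) refl c (fromℕ n) h)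
    step : ((c + h) <ℝ x) ⊎ (x ℝ< (c + (h + h))) → Σ ℚ (λ u → (u <ℝ x) × (x ℝ< (u + (h + h))))
    step (inj₁ c+h<x)  = scan 0<h n (c + h) c+h<x (subst (x ℝ<_) one-step x<c+[n+1]h)
    step (inj₂ x<c+2h) = c , c<x , x<c+2h

  enclose : ∀ {h} → 0ℚ < h → Σ ℚ (λ u → (u <ℝ x) × (x ℝ< (u + (h + h))))
  enclose 0<h =
    let a , a<x = lowerBound
        b , x<b = upperBound
        n , b<a+nh = exceeds a b 0<h
    in scan 0<h n a a<x (upward x x<b b<a+nh)

lemma3p19 : (x : ℝD) → Locator x → (ε : ℚ) → 0ℚ < ε →
    Σ ℚ (λ u → Σ ℚ (λ v → (u <ℝ x) × (x ℝ< v) × ((v - u) < ε)))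
lemma3p19 x locate ε 0<ε =
  let u , u<x , x<u+2h = WithLocator.enclose x locate (half-pos (half-pos 0<ε))
  in u , u + (h + h) , u<x , x<u+2h , width u
  where
  h : ℚ
  h = ½ * (½ * ε)
  width : ∀ u → (u + (h + h)) - u < ε
  width u = begin-strict
    (u + (h + h)) - u   ≡⟨ solve 2 (λ u d → (u :+ d) :- u := d) refl u (h + h) ⟩
    h + h               ≡⟨ half+half (½ * ε) ⟩
    ½ * ε               <⟨ half<self 0<ε ⟩
    ε                   ∎
    where open ≤-Reasoning
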